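{- Let $\Gamma,\Delta,\Sigma$ be finite sets of propositional formulas with $\Delta$ non-empty. Then from the sequent $\Gamma\vdash_M\Delta$ one can derive $\Gamma\vdash_M\Delta,\Sigma$ in $\mathsf{MLK}$ by a derivation (using $\Gamma\vdash_M\Delta$ as a premise) of size polynomial in the sizes of $\Gamma,\Delta,\Sigma$.
   Context: $\mathsf{LK}$ is Gentzen's propositional sequent calculus on sequents $\Gamma\vdash\Delta$ of finite sets of formulas (axioms $A\vdash A$, $\bot\vdash$, $\vdash\top$; weakening on both sides; standard left/right rules for $\neg,\wedge,\vee,\rightarrow$; cut). $\mathsf{MLK}$ (Olivetti's calculus for minimal entailment, on sequents $\Gamma\vdash_M\Delta$ meaning every inclusion-minimal model of $\bigwedge\Gamma$ satisfies $\bigvee\Delta$) consists of all $\mathsf{LK}$ axioms and rules together with: axiom $\Gamma\vdash_M\neg p$ for every atom $p$ not occurring positively in any formula of $\Gamma$; from $\Gamma\vdash\Delta$ infer $\Gamma\vdash_M\Delta$; M-cut: from $\Gamma\vdash_M\Sigma,A$ and $A,\Gamma\vdash_M\Lambda$ infer $\Gamma\vdash_M\Sigma,\Lambda$; from $\Gamma\vdash_M\Sigma$ and $\Gamma\vdash_M\Delta$ infer $\Gamma,\Sigma\vdash_M\Delta$; from $\Gamma\vdash_M\Sigma,A$ and $\Gamma\vdash_M\Sigma,B$ infer $\Gamma\vdash_M\Sigma,A\wedge B$; from $A,\Gamma\vdash_M\Sigma$ and $B,\Gamma\vdash_M\Sigma$ infer $A\vee B,\Gamma\vdash_M\Sigma$;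 from $\Gamma\vdash_M\Sigma,A$ infer $\Gamma\vdash_M\Sigma,B\vee A$ and $\Gamma\vdash_M\Sigma,A\vee B$; from $A,\Gamma\vdash_M\Sigma$ infer $\Gamma\vdash_M\Sigma,\neg A$; from $A,\Gamma\vdash_M\Sigma,B$ infer $\Gamma\vdash_M\Sigma,A\rightarrow B$. -}

module Defs where

open import Data.Nat using (ℕ; zero; suc; _+_; _*_; _^_; _≤_)
open import Data.List using (List; []; _∷_; _++_)
open import Data.List.Membership.Propositional using (_∈_)
open import Data.Product using (_×_; _,_)
open import Relation.Nullary using (¬_)

Atom : Set
Atom = ℕ

infixr 9 _∧'_
infixr 8 _∨'_
infixr 7 _⇒'_

infix 10 ¬'_

data Formula : Set where
  atom  : Atom → Formula
  ⊥'    : Formula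
  ⊤'    : Formula
  ¬'_   : Formula → Formula
  _∧'_  : Formula → Formula → Formula
  _∨'_  : Formula → Formula → Formula
  _⇒'_  : Formula → Formula → Formula

fsize : Formula → ℕ
fsize (atom _) = 1
fsize ⊥' = 1
fsize ⊤' = 1
fsize (¬' A) = suc (fsize A)
fsize (A ∧' B) = suc (fsize A + fsize B)
fsize (A ∨' B) = suc (fsize A + fsize B)
fsize (A ⇒' B) = suc (fsize A + fsize B)

lsize : List Formula → ℕ
lsize [] = 0
lsize (A ∷ Γ) = fsize A + lsize Γ

mutual
  data Pos (p : Atom) : Formula → Set where
    pos-atom : Pos p (atom p)
    pos-¬    : ∀ {A} → Neg p A → Pos p (¬' A)
    pos-∧l   : ∀ {A B} → Pos p A → Pos p (A ∧' B)
    pos-∧r   : ∀ {A B} → Pos p B → Pos p (A ∧' B)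
    pos-∨l   : ∀ {A B} → Pos p A → Pos p (A ∨' B)
    pos-∨r   : ∀ {A B} → Pos p B → Pos p (A ∨' B)
    pos-⇒l   : ∀ {A B} → Neg p A → Pos p (A ⇒' B)
    pos-⇒r   : ∀ {A B} → Pos p B → Pos p (A ⇒' B)

  data Neg (p : Atom) : Formula → Set where
    neg-¬    : ∀ {A} → Pos p A → Neg p (¬' A)
    neg-∧l   : ∀ {A B} → Neg p A → Neg p (A ∧' B)
    neg-∧r   : ∀ {A B} → Neg p B → Neg p (A ∧' B)
    neg-∨l   : ∀ {A B} → Neg p A → Neg p (A ∨' B)
    neg-∨r   : ∀ {A B} → Neg p B → Neg p (A ∨' B)
    neg-⇒l   : ∀ {A B} → Pos p A → Neg p (A ⇒' B)
    neg-⇒r   : ∀ {A B} → Neg p B → Neg p (A ⇒' B)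

data PosIn (p : Atom) : List Formula → Set where
  here  : ∀ {A Γ} → Pos p A → PosIn p (A ∷ Γ)
  there : ∀ {A Γ} → PosIn p Γ → PosIn p (A ∷ Γ)

-- Sequents.  Finite sets of formulas are represented by lists, taken
-- modulo set equality _≋_ (same members); see the conversion rule `set`.

_≋_ : List Formula → List Formula → Set
Γ ≋ Γ' = ∀ A → (A ∈ Γ → A ∈ Γ') × (A ∈ Γ' → A ∈ Γ)

-- classical sequent Γ ⊢ Δ  or minimal-entailment sequent Γ ⊢_M Δ
data Kind : Set where
  LK M : Kind

record Seq : Set where
  constructor seq
  field
    kind : Kind
    ante : List Formula
    succ : List Formula

infix 3 _⊢_ _⊢M_
_⊢_ : List Formula → List Formula → Seq
Γ ⊢ Δ = seq LK Γ Δ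

_⊢M_ : List Formula → List Formula → Seq
Γ ⊢M Δ = seq M Γ Δ

ssize : Seq → ℕ
ssize (seq _ Γ Δ) = lsize Γ + lsize Δ

-- MLK derivations of a sequent from a single premise sequent P.
-- (In a set-based calculus, "Γ , A" is A ∷ Γ and "Γ , Σ" is Γ ++ Σ.)

data Der (P : Seq) : Seq → Set where
  hyp   : Der P P
  set   : ∀ {k Γ Γ' Δ Δ'} → Γ ≋ Γ' → Δ ≋ Δ' →
          Der P (seq k Γ Δ) → Der P (seq k Γ' Δ')
  ax    : ∀ A → Der P ((A ∷ []) ⊢ (A ∷ []))
  ax⊥   : Der P ((⊥' ∷ []) ⊢ [])
  ax⊤   : Der P ([] ⊢ (⊤' ∷ []))
  wL    : ∀ {Γ Δ} A → Der P (Γ ⊢ Δ) → Der P (A ∷ Γ ⊢ Δ)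
  wR    : ∀ {Γ Δ} A → Der P (Γ ⊢ Δ) → Der P (Γ ⊢ A ∷ Δ)
  ¬L    : ∀ {Γ Δ A} → Der P (Γ ⊢ A ∷ Δ) → Der P (¬' A ∷ Γ ⊢ Δ)
  ¬R    : ∀ {Γ Δ A} → Der P (A ∷ Γ ⊢ Δ) → Der P (Γ ⊢ ¬' A ∷ Δ)
  ∧L₁   : ∀ {Γ Δ A} B → Der P (A ∷ Γ ⊢ Δ) → Der P (A ∧' B ∷ Γ ⊢ Δ)
  ∧L₂   : ∀ {Γ Δ B} A → Der P (B ∷ Γ ⊢ Δ) → Der P (A ∧' B ∷ Γ ⊢ Δ)
  ∧R    : ∀ {Γ Δ A B} → Der P (Γ ⊢ A ∷ Δ) → Der P (Γ ⊢ B ∷ Δ) →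
          Der P (Γ ⊢ A ∧' B ∷ Δ)
  ∨L    : ∀ {Γ Δ A B} → Der P (A ∷ Γ ⊢ Δ) → Der P (B ∷ Γ ⊢ Δ) →
          Der P (A ∨' B ∷ Γ ⊢ Δ)
  ∨R₁   : ∀ {Γ Δ A} B → Der P (Γ ⊢ A ∷ Δ) → Der P (Γ ⊢ A ∨' B ∷ Δ)
  ∨R₂   : ∀ {Γ Δ B} A → Der P (Γ ⊢ B ∷ Δ) → Der P (Γ ⊢ A ∨' B ∷ Δ)
  ⇒L    : ∀ {Γ Δ A B} → Der P (Γ ⊢ A ∷ Δ) → Der P (B ∷ Γ ⊢ Δ) →
          Der P (A ⇒' B ∷ Γ ⊢ Δ)
  ⇒R    : ∀ {Γ Δ A B} → Der P (A ∷ Γ ⊢ B ∷ Δ) → Der P (Γ ⊢ A ⇒' B ∷ Δ)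
  cut   : ∀ {Γ Δ} A → Der P (Γ ⊢ A ∷ Δ) → Der P (A ∷ Γ ⊢ Δ) → Der P (Γ ⊢ Δ)
  axM   : ∀ Γ p → ¬ PosIn p Γ → Der P (Γ ⊢M ¬' atom p ∷ [])
  LK→M  : ∀ {Γ Δ} → Der P (Γ ⊢ Δ) → Der P (Γ ⊢M Δ)
  Mcut  : ∀ {Γ Σ Λ} A → Der P (Γ ⊢M A ∷ Σ) → Der P (A ∷ Γ ⊢M Λ) →
          Der P (Γ ⊢M Σ ++ Λ)
  Mcum  : ∀ {Γ Σ Δ} → Der P (Γ ⊢M Σ) → Der P (Γ ⊢M Δ) → Der P (Γ ++ Σ ⊢M Δ)
  M∧R   : ∀ {Γ Σ A B} → Der P (Γ ⊢M A ∷ Σ) → Der P (Γ ⊢M B ∷ Σ) →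
          Der P (Γ ⊢M A ∧' B ∷ Σ)
  M∨L   : ∀ {Γ Σ A B} → Der P (A ∷ Γ ⊢M Σ) → Der P (B ∷ Γ ⊢M Σ) →
          Der P (A ∨' B ∷ Γ ⊢M Σ)
  M∨R₁  : ∀ {Γ Σ A} B → Der P (Γ ⊢M A ∷ Σ) → Der P (Γ ⊢M B ∨' A ∷ Σ)
  M∨R₂  : ∀ {Γ Σ A} B → Der P (Γ ⊢M A ∷ Σ) → Der P (Γ ⊢M A ∨' B ∷ Σ)
  M¬R   : ∀ {Γ Σ A} → Der P (A ∷ Γ ⊢M Σ) → Der P (Γ ⊢M ¬' A ∷ Σ)
  M⇒R   : ∀ {Γ Σ A B} → Der P (A ∷ Γ ⊢M B ∷ Σ) → Der P (Γ ⊢M A ⇒' B ∷ Σ)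

-- The set-equality conversion is bookkeeping for finite sets and is free.
dsize : ∀ {P S} → Der P S → ℕ
dsize {S = S} hyp = suc (ssize S)
dsize (set _ _ d) = dsize d
dsize {S = S} (ax _) = suc (ssize S)
dsize {S = S} ax⊥ = suc (ssize S)
dsize {S = S} ax⊤ = suc (ssize S)
dsize {S = S} (wL _ d) = suc (ssize S + dsize d)
dsize {S = S} (wR _ d) = suc (ssize S + dsize d)
dsize {S = S} (¬L d) = suc (ssize S + dsize d)
dsize {S = S} (¬R d) = suc (ssize S + dsize d)
dsize {S = S} (∧L₁ _ d) = suc (ssize S + dsize d)
dsize {S = S} (∧L₂ _ d) = suc (ssize S + dsize d)
dsize {S = S} (∧R d e) = suc (ssize S + dsize d + dsize e)
dsize {S = S} (∨L d e) = suc (ssize S + dsize d + dsize e)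
dsize {S = S} (∨R₁ _ d) = suc (ssize S + dsize d)
dsize {S = S} (∨R₂ _ d) = suc (ssize S + dsize d)
dsize {S = S} (⇒L d e) = suc (ssize S + dsize d + dsize e)
dsize {S = S} (⇒R d) = suc (ssize S + dsize d)
dsize {S = S} (cut _ d e) = suc (ssize S + dsize d + dsize e)
dsize {S = S} (axM _ _ _) = suc (ssize S)
dsize {S = S} (LK→M d) = suc (ssize S + dsize d)
dsize {S = S} (Mcut _ d e) = suc (ssize S + dsize d + dsize e)
dsize {S = S} (Mcum d e) = suc (ssize S + dsize d + dsize e)
dsize {S = S} (M∧R d e) = suc (ssize S + dsize d + dsize e)
dsize {S = S} (M∨L d e) = suc (ssize S + dsize d + dsize e)
dsize {S = S} (M∨R₁ _ d) = suc (ssize S + dsize d)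
dsize {S = S} (M∨R₂ _ d) = suc (ssize S + dsize d)
dsize {S = S} (M¬R d) = suc (ssize S + dsize d)
dsize {S = S} (M⇒R d) = suc (ssize S + dsize d)

-- Right weakening is admissible for ⊢_M as soon as the succedent contains
-- some formula D.  The sequent D, Γ ⊢ D, Σ is a weakened LK axiom, hence an
-- M-sequent; an M-cut on D against the premise Γ ⊢_M D, Δ yields
-- Γ ⊢_M Δ, D, Σ.  The derivation has |Γ| + |Σ| + O(1) rule applications,
-- each on a sequent of size at most twice the input size, so its size is
-- quadratic.
module Submission where

open import Defs
open import Data.Nat using (ℕ; suc; _+_; _*_; _^_; _≤_)
open import Data.List using (List; []; _++_)
open import Data.Product using (Σ; ∃; _×_)
open import Relation.Nullary using (¬_)
open import Relation.Binary.PropositionalEquality using (_≡_)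

open import Data.Nat using (_<_; s≤s; z≤n)
open import Data.Nat.Properties
open import Data.Nat.ListAction using (sum)
open import Data.Nat.ListAction.Properties using (sum-↭)
open import Data.Nat.Tactic.RingSolver using (solve-∀)
open import Data.List using (_∷_; [_]; map)
open import Data.List.Relation.Binary.Permutation.Propositional using (_↭_; ↭-sym)
open import Data.List.Relation.Binary.Permutation.Propositional.Properties
  using (∈-resp-↭; ∷↭∷ʳ; shift; map⁺)
open import Data.Product using (_,_)
open import Data.Empty using (⊥-elim)
open import Relation.Binary.PropositionalEquality using (refl; sym; trans; cong; cong₂; subst)

↭⇒≋ : ∀ {Γ Γ'} → Γ ↭ Γ' → Γ ≋ Γ'
↭⇒≋ p A = ∈-resp-↭ p , ∈-resp-↭ (↭-sym p)

≋-refl : ∀ {Γ} → Γ ≋ Γ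
≋-refl A = (λ A∈Γ → A∈Γ) , (λ A∈Γ → A∈Γ)

0<fsize : ∀ A → 0 < fsize A
0<fsize (atom _) = s≤s z≤n
0<fsize ⊥' = s≤s z≤n
0<fsize ⊤' = s≤s z≤n
0<fsize (¬' _) = s≤s z≤n
0<fsize (_ ∧' _) = s≤s z≤n
0<fsize (_ ∨' _) = s≤s z≤n
0<fsize (_ ⇒' _) = s≤s z≤n

lsize≡sum : ∀ Γ → lsize Γ ≡ sum (map fsize Γ)
lsize≡sum [] = refl
lsize≡sum (A ∷ Γ) = cong (fsize A +_) (lsize≡sum Γ)

lsize-↭ : ∀ {Γ Γ'} → Γ ↭ Γ' → lsize Γ ≡ lsize Γ'
lsize-↭ {Γ} {Γ'} p =
  trans (lsize≡sum Γ) (trans (sum-↭ (map⁺ fsize p)) (sym (lsize≡sum Γ')))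

lsize-++ : ∀ Γ Δ → lsize (Γ ++ Δ) ≡ lsize Γ + lsize Δ
lsize-++ [] Δ = refl
lsize-++ (A ∷ Γ) Δ = trans (cong (fsize A +_) (lsize-++ Γ Δ)) (sym (+-assoc (fsize A) _ _))

lsize-++ʳ-≤ : ∀ Γ {Δ} → lsize Δ ≤ lsize (Γ ++ Δ)
lsize-++ʳ-≤ [] = ≤-refl
lsize-++ʳ-≤ (A ∷ Γ) = ≤-trans (lsize-++ʳ-≤ Γ) (m≤n+m _ (fsize A))

-- One weakening step on a sequent of size at most b costs at most suc b,
-- which is paid for by the (positive) size f of the weakening formula.
weakening-step : ∀ {a x y z f b} → a ≤ b → x ≤ y + z * suc b → 0 < f →
                 suc (a + x) ≤ y + (f + z) * suc b
weakening-step {a} {x} {y} {z} {f} {b} a≤b x≤ 0<f = begin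
  suc (a + x)             ≤⟨ s≤s (+-mono-≤ a≤b x≤) ⟩
  suc b + (y + z * suc b) ≡⟨ reassociate b y z ⟩
  y + (1 + z) * suc b     ≤⟨ +-monoʳ-≤ y (*-monoˡ-≤ (suc b) (+-monoˡ-≤ z 0<f)) ⟩
  y + (f + z) * suc b     ∎
  where
  open ≤-Reasoning
  reassociate : ∀ b y z → suc b + (y + z * suc b) ≡ y + (1 + z) * suc b
  reassociate = solve-∀

module _ {P : Seq} where

  weakenˡ : ∀ {Γ Δ} Σ → Der P (Γ ⊢ Δ) → Der P (Σ ++ Γ ⊢ Δ)
  weakenˡ [] d = d
  weakenˡ (A ∷ Σ) d = wL A (weakenˡ Σ d)

  weakenʳ : ∀ {Γ Δ} Σ → Der P (Γ ⊢ Δ) → Der P (Γ ⊢ Σ ++ Δ)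
  weakenʳ [] d = d
  weakenʳ (A ∷ Σ) d = wR A (weakenʳ Σ d)

  dsize-weakenˡ : ∀ {Γ Δ} b Σ (d : Der P (Γ ⊢ Δ)) → ssize (Σ ++ Γ ⊢ Δ) ≤ b →
                  dsize (weakenˡ Σ d) ≤ dsize d + lsize Σ * suc b
  dsize-weakenˡ b [] d _ = m≤m+n _ _
  dsize-weakenˡ {Δ = Δ} b (A ∷ Σ) d h = weakening-step h
    (dsize-weakenˡ b Σ d (≤-trans (+-monoˡ-≤ (lsize Δ) (m≤n+m _ (fsize A))) h))
    (0<fsize A)

  dsize-weakenʳ : ∀ {Γ Δ} b Σ (d : Der P (Γ ⊢ Δ)) → ssize (Γ ⊢ Σ ++ Δ) ≤ b →
                  dsize (weakenʳ Σ d) ≤ dsize d + lsize Σ * suc b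
  dsize-weakenʳ b [] d _ = m≤m+n _ _
  dsize-weakenʳ {Γ = Γ} b (A ∷ Σ) d h = weakening-step h
    (dsize-weakenʳ b Σ d (≤-trans (+-monoʳ-≤ (lsize Γ) (m≤n+m _ (fsize A))) h))
    (0<fsize A)

  ax-in-context : ∀ Γ Σ A → Der P (A ∷ Γ ⊢ A ∷ Σ)
  ax-in-context Γ Σ A =
    set (↭⇒≋ (↭-sym (∷↭∷ʳ A Γ))) (↭⇒≋ (↭-sym (∷↭∷ʳ A Σ))) (weakenˡ Γ (weakenʳ Σ (ax A)))

  dsize-ax-in-context : ∀ b Γ Σ A → ssize (A ∷ Γ ⊢ A ∷ Σ) ≤ b →
    dsize (ax-in-context Γ Σ A) ≤ suc b + lsize Σ * suc b + lsize Γ * suc b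
  dsize-ax-in-context b Γ Σ A h = begin
    dsize (weakenˡ Γ (weakenʳ Σ (ax A)))
      ≤⟨ dsize-weakenˡ b Γ _ weakened≤ ⟩
    dsize (weakenʳ Σ (ax A)) + lsize Γ * suc b
      ≤⟨ +-monoˡ-≤ _ (dsize-weakenʳ b Σ _ right-weakened≤) ⟩
    dsize (ax {P = P} A) + lsize Σ * suc b + lsize Γ * suc b
      ≤⟨ +-monoˡ-≤ _ (+-monoˡ-≤ _ (s≤s axiom≤)) ⟩
    suc b + lsize Σ * suc b + lsize Γ * suc b ∎
    where
    open ≤-Reasoning
    weakened≤ : ssize (Γ ++ [ A ] ⊢ Σ ++ [ A ]) ≤ b
    weakened≤ = subst (_≤ b) (cong₂ _+_ (lsize-↭ (∷↭∷ʳ A Γ)) (lsize-↭ (∷↭∷ʳ A Σ))) h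
    right-weakened≤ : ssize ([ A ] ⊢ Σ ++ [ A ]) ≤ b
    right-weakened≤ = ≤-trans (+-monoˡ-≤ _ (lsize-++ʳ-≤ Γ)) weakened≤
    axiom≤ : ssize ([ A ] ⊢ [ A ]) ≤ b
    axiom≤ = ≤-trans (+-monoʳ-≤ _ (lsize-++ʳ-≤ Σ)) right-weakened≤

  M-weakenʳ : ∀ {Γ A Δ} Σ → Der P (Γ ⊢M A ∷ Δ) → Der P (Γ ⊢M (A ∷ Δ) ++ Σ)
  M-weakenʳ {Γ} {A} {Δ} Σ d =
    set ≋-refl (↭⇒≋ (shift A Δ Σ)) (Mcut A d (LK→M (ax-in-context Γ Σ A)))

  dsize-M-weakenʳ : ∀ {Γ A Δ} Σ (d : Der P (Γ ⊢M A ∷ Δ)) →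
    let n = lsize Γ + lsize (A ∷ Δ) + lsize Σ in
    dsize (M-weakenʳ Σ d) ≤ dsize d + (3 + lsize Γ + lsize Σ) * suc (n + n)
  dsize-M-weakenʳ {Γ} {A} {Δ} Σ d = begin
    suc (ssize (Γ ⊢M Δ ++ A ∷ Σ) + dsize d
         + suc (ssize (A ∷ Γ ⊢ A ∷ Σ) + dsize (ax-in-context Γ Σ A)))
      ≤⟨ s≤s (+-mono-≤ (+-monoˡ-≤ _ conclusion≤)
                       (s≤s (+-mono-≤ context≤ (dsize-ax-in-context b Γ Σ A context≤)))) ⟩
    suc (b + dsize d + suc (b + (suc b + s * suc b + g * suc b)))
      ≡⟨ collect b (dsize d) g s ⟩
    dsize d + (3 + g + s) * suc b ∎
    where
    open ≤-Reasoning
    g e e' s n b : ℕ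
    g = lsize Γ
    e = fsize A
    e' = lsize Δ
    s = lsize Σ
    n = g + (e + e') + s
    b = n + n
    conclusion≡ : ssize (Γ ⊢M Δ ++ A ∷ Σ) ≡ n
    conclusion≡ = begin-equality
      g + lsize (Δ ++ A ∷ Σ) ≡⟨ cong (g +_) (lsize-↭ (shift A Δ Σ)) ⟩
      g + (e + lsize (Δ ++ Σ)) ≡⟨ cong (λ x → g + (e + x)) (lsize-++ Δ Σ) ⟩
      g + (e + (e' + s))       ≡⟨ regroup g e e' s ⟩
      n                        ∎
      where
      regroup : ∀ g e e' s → g + (e + (e' + s)) ≡ g + (e + e') + s
      regroup = solve-∀
    conclusion≤ : ssize (Γ ⊢M Δ ++ A ∷ Σ) ≤ b
    conclusion≤ = ≤-trans (≤-reflexive conclusion≡) (m≤m+n n n)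
    context≤ : ssize (A ∷ Γ ⊢ A ∷ Σ) ≤ b
    context≤ = subst (ssize (A ∷ Γ ⊢ A ∷ Σ) ≤_) (sym (split g e e' s)) (m≤m+n _ _)
      where
      split : ∀ g e e' s → (g + (e + e') + s) + (g + (e + e') + s)
                         ≡ (e + g + (e + s)) + (g + e' + e' + s)
      split = solve-∀
    collect : ∀ b x g s → suc (b + x + suc (b + (suc b + s * suc b + g * suc b)))
                        ≡ x + (3 + g + s) * suc b
    collect = solve-∀

quadratic-bound : ∀ n → suc n + (3 + n) * suc (n + n) ≤ 4 * suc n ^ 2
quadratic-bound n =
  subst (suc n + (3 + n) * suc (n + n) ≤_) (expand n) (m≤m+n _ (2 * (n * n)))
  where
  expand : ∀ n → suc n + (3 + n) * suc (n + n) + 2 * (n * n) ≡ 4 * (suc n * (suc n * 1))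
  expand = solve-∀

lemma2 : Σ ℕ λ c → Σ ℕ λ k →
    ∀ (Γ Δ Σ' : List Formula) → ¬ (Δ ≡ []) →
    Σ (Der (Γ ⊢M Δ) (Γ ⊢M Δ ++ Σ')) λ d →
      dsize d ≤ c * suc (lsize Γ + lsize Δ + lsize Σ') ^ k
lemma2 = 4 , 2 , weaken-premise
  where
  weaken-premise : ∀ (Γ Δ Σ' : List Formula) → ¬ (Δ ≡ []) →
    Σ (Der (Γ ⊢M Δ) (Γ ⊢M Δ ++ Σ')) λ d →
      dsize d ≤ 4 * suc (lsize Γ + lsize Δ + lsize Σ') ^ 2
  weaken-premise Γ [] Σ' Δ≢[] = ⊥-elim (Δ≢[] refl)
  weaken-premise Γ (D ∷ Δ) Σ' _ = weakened , (begin
    dsize weakened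
      ≤⟨ dsize-M-weakenʳ {Γ = Γ} {D} {Δ} Σ' hyp ⟩
    suc (ssize (Γ ⊢M D ∷ Δ)) + (3 + lsize Γ + lsize Σ') * suc (n + n)
      ≤⟨ +-mono-≤ (s≤s (m≤m+n (ssize (Γ ⊢M D ∷ Δ)) (lsize Σ')))
                  (*-monoˡ-≤ (suc (n + n)) (+-monoʳ-≤ 3 Γ,Σ'≤n)) ⟩
    suc n + (3 + n) * suc (n + n)
      ≤⟨ quadratic-bound n ⟩
    4 * suc n ^ 2 ∎)
    where
    open ≤-Reasoning
    n : ℕ
    n = lsize Γ + lsize (D ∷ Δ) + lsize Σ'
    Γ,Σ'≤n : lsize Γ + lsize Σ' ≤ n
    Γ,Σ'≤n = +-monoˡ-≤ (lsize Σ') (m≤m+n (lsize Γ) (lsize (D ∷ Δ)))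
    weakened : Der (Γ ⊢M D ∷ Δ) (Γ ⊢M (D ∷ Δ) ++ Σ')
    weakened = M-weakenʳ Σ' hyp
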